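{- We have $h_q(-1)=0$, $h_q(0)=1$, and for all $n\ge1$, $$h_q(2n-1)=q\,h_q(n-1),\qquad h_q(2n)=h_q(n)+q^2h_q(n-1).$$
   Context: A hyperbinary partition of an integer $n\ge0$ is a partition of $n$ in which every part is a power of $2$ and each part occurs at most twice; $H(n)$ denotes the set of these, with $H(0)$ consisting of the empty partition and $H(-1)=\emptyset$. $h_q(n)=\sum_{\eta\in H(n)}q^{\ell(\eta)}$, where $\ell(\eta)$ is the number of parts of $\eta$. -}

module Defs where

open import Data.Nat as ℕ using (ℕ; zero; suc; _≟_)
open import Data.Integer as ℤ using (ℤ; +_; -[1+_])
open import Data.List using (List; []; _∷_; map; concatMap; filter; upTo; foldr; length; last)
open import Data.Maybe using (Maybe; just; nothing)
open import Relation.Nullary using (Dec; yes; no; ¬_)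
open import Relation.Nullary.Decidable using (¬?)
open import Algebra.Bundles using (CommutativeSemiring)
open import Level using (Level)

-- A hyperbinary partition is encoded by its multiplicity list
-- d₀ ∷ d₁ ∷ … ∷ d_k, where dᵢ ∈ {0,1,2} is the number of parts equal to 2^i,
-- with no trailing zero (so that the encoding of a partition is unique;
-- the empty partition is the empty list).

Mult : Set
Mult = List ℕ

value : Mult → ℕ
value []      = 0
value (d ∷ ds) = d ℕ.+ 2 ℕ.* value ds

numParts : Mult → ℕ
numParts []       = 0
numParts (d ∷ ds) = d ℕ.+ numParts ds

allOfLength : ℕ → List Mult
allOfLength zero    = [] ∷ []
allOfLength (suc k) = concatMap (λ ds → map (_∷ ds) (0 ∷ 1 ∷ 2 ∷ [])) (allOfLength k)

NoTrailingZero : Mult → Set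
NoTrailingZero ds with last ds
... | nothing = Data.Unit.⊤ where import Data.Unit
... | just d  = ¬ (d Relation.Binary.PropositionalEquality.≡ 0)
  where import Relation.Binary.PropositionalEquality

noTrailingZero? : (ds : Mult) → Dec (NoTrailingZero ds)
noTrailingZero? ds with last ds
... | nothing = yes Data.Unit.tt where import Data.Unit
... | just d  = ¬? (d ≟ 0)

-- H(n) for n ≥ 0: every hyperbinary partition of n uses parts 2^i ≤ n,
-- hence i < n + 1, so its multiplicity list has length ≤ n.
-- (length k ≤ n suffices: the top part 2^(k-1) ≤ n < 2^n when k ≥ 1.)
Hℕ : ℕ → List Mult
Hℕ n = filter (λ ds → value ds ≟ n)
         (filter noTrailingZero? (concatMap allOfLength (upTo (suc n))))

H : ℤ → List Mult
H (+ n)    = Hℕ n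
H -[1+ _ ] = []

module _ {c ℓ : Level} (R : CommutativeSemiring c ℓ) where
  open CommutativeSemiring R

  pow : Carrier → ℕ → Carrier
  pow x zero    = 1#
  pow x (suc k) = x * pow x k

  h : Carrier → ℤ → Carrier
  h q n = foldr (λ η acc → pow q (numParts η) + acc) 0# (H n)

{-# OPTIONS --safe #-}
-- Sort a hyperbinary partition of n by the multiplicity d ∈ {0,1,2} of the part 1: removing
-- these parts and halving the others leaves a hyperbinary partition of (n - d)/2 with d fewer
-- parts. For n = 2m+1 only d = 1 is possible; for n = 2m+2 either d = 0 or d = 2.
-- On multiplicity lists this removes the head digit, so the recursion holds separately for the
-- contribution hLength n k of the lists of each length k. The truncation at length n in Hℕ is
-- harmless, because by the same recursion the partial sums hBelow n N stop changing once N > n.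

module Submission where

open import Defs
open import Algebra.Bundles using (CommutativeSemiring)
open import Data.Bool using (Bool; true; false; if_then_else_)
open import Data.Fin using (toℕ)
open import Data.Integer as ℤ using (+_; -[1+_])
open import Data.List using (List; []; _∷_; _++_; concatMap; filter; foldr; last; applyUpTo; upTo)
open import Data.Maybe using (just; nothing)
open import Data.Nat as ℕ using (ℕ; zero; suc; _≟_; _<_; s≤s; s≤s⁻¹)
open import Data.Nat.Properties
  using (even≢odd; suc-injective; *-suc; *-cancelˡ-≡; +-suc; m≤m+n; n≤1+n; n<1+n; ≤-trans; m≤n⇒m<n∨m≡n)
open import Data.Product using (_×_; _,_)
open import Data.Sum using (inj₁; inj₂)
open import Function using (_∘_; id; mk⇔)
open import Level using (Level)
open import Relation.Nullary using (does)
open import Relation.Nullary.Decidable using (dec-false; does-⇔)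
open import Relation.Unary using (Pred; Decidable)
open import Relation.Binary.PropositionalEquality as ≡ using (_≡_; _≢_)

data Halving : ℕ → Set where
  zero  : Halving 0
  1+2*_ : ∀ m → Halving (suc (2 ℕ.* m))
  2+2*_ : ∀ m → Halving (suc (suc (2 ℕ.* m)))

halving : ∀ n → Halving n
halving zero = zero
halving (suc n) with halving n
... | zero   = 1+2* 0
... | 1+2* m = 2+2* m
... | 2+2* m = ≡.subst Halving (≡.cong suc (*-suc 2 m)) (1+2* suc m)

does-2*-≟ : ∀ v m → does (2 ℕ.* v ≟ 2 ℕ.* m) ≡ does (v ≟ m)
does-2*-≟ v m = does-⇔ (mk⇔ (*-cancelˡ-≡ v m 2) (≡.cong (2 ℕ.*_))) (2 ℕ.* v ≟ 2 ℕ.* m) (v ≟ m)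

noTrailingZero?-∷ : ∀ d e es → does (noTrailingZero? (d ∷ e ∷ es)) ≡ does (noTrailingZero? (e ∷ es))
noTrailingZero?-∷ d e es with last (e ∷ es)
... | nothing = ≡.refl
... | just _  = ≡.refl

digits : List ℕ
digits = 0 ∷ 1 ∷ 2 ∷ []

module _ {c ℓ : Level} (R : CommutativeSemiring c ℓ) where
  open CommutativeSemiring R
  open import Relation.Binary.Reasoning.Setoid setoid
  open import Algebra.Properties.CommutativeSemigroup +-commutativeSemigroup using (interchange)
  open import Algebra.Properties.Semiring.Sum semiring
    using (sum-syntax; sum-cong-≋; sum-replicate-zero; ∑-distrib-+; *-distribˡ-sum)

  guard : Bool → Carrier → Carrier
  guard b x = if b then x else 0#

  guard-cong : ∀ b {x y} → x ≈ y → guard b x ≈ guard b y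
  guard-cong true  x≈y = x≈y
  guard-cong false _   = refl

  guard-0# : ∀ b → guard b 0# ≡ 0#
  guard-0# true  = ≡.refl
  guard-0# false = ≡.refl

  guard-+ : ∀ b x y → guard b (x + y) ≈ guard b x + guard b y
  guard-+ true  x y = refl
  guard-+ false x y = sym (+-identityˡ 0#)

  guard-*ˡ : ∀ b x y → guard b (x * y) ≈ x * guard b y
  guard-*ˡ true  x y = refl
  guard-*ˡ false x y = sym (zeroʳ x)

  [_≡_]_ : ℕ → ℕ → Carrier → Carrier
  [ v ≡ n ] x = guard (does (v ≟ n)) x

  [≢]≡0# : ∀ {v n} x → v ≢ n → [ v ≡ n ] x ≡ 0#
  [≢]≡0# {v} {n} x v≢n = ≡.cong (λ b → guard b x) (dec-false (v ≟ n) v≢n)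

  [2*≡2*] : ∀ v m x → [ 2 ℕ.* v ≡ 2 ℕ.* m ] x ≡ [ v ≡ m ] x
  [2*≡2*] v m x = ≡.cong (λ b → guard b x) (does-2*-≟ v m)

  module _ {A : Set} where
    sumOver : (A → Carrier) → List A → Carrier
    sumOver f = foldr (λ x acc → f x + acc) 0#

    sumOver-cong : ∀ {f g} xs → (∀ x → f x ≈ g x) → sumOver f xs ≈ sumOver g xs
    sumOver-cong []       f≈g = refl
    sumOver-cong (x ∷ xs) f≈g = +-cong (f≈g x) (sumOver-cong xs f≈g)

    sumOver-zero : ∀ {f} xs → (∀ x → f x ≈ 0#) → sumOver f xs ≈ 0#
    sumOver-zero []       f≈0 = refl
    sumOver-zero (x ∷ xs) f≈0 = trans (+-cong (f≈0 x) (sumOver-zero xs f≈0)) (+-identityˡ 0#)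

    sumOver-++ : ∀ f xs ys → sumOver f (xs ++ ys) ≈ sumOver f xs + sumOver f ys
    sumOver-++ f []       ys = sym (+-identityˡ _)
    sumOver-++ f (x ∷ xs) ys = trans (+-congˡ (sumOver-++ f xs ys)) (sym (+-assoc _ _ _))

    sumOver-+ : ∀ f g xs → sumOver (λ x → f x + g x) xs ≈ sumOver f xs + sumOver g xs
    sumOver-+ f g []       = sym (+-identityˡ 0#)
    sumOver-+ f g (x ∷ xs) = trans (+-congˡ (sumOver-+ f g xs)) (interchange _ _ _ _)

    sumOver-*ˡ : ∀ a f xs → sumOver (λ x → a * f x) xs ≈ a * sumOver f xs
    sumOver-*ˡ a f []       = sym (zeroʳ a)
    sumOver-*ˡ a f (x ∷ xs) = trans (+-congˡ (sumOver-*ˡ a f xs)) (sym (distribˡ a _ _))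

    sumOver-guard : ∀ b f xs → sumOver (λ x → guard b (f x)) xs ≈ guard b (sumOver f xs)
    sumOver-guard true  f xs = refl
    sumOver-guard false f xs = sumOver-zero xs (λ _ → refl)

    sumOver-filter : ∀ {p} {P : Pred A p} (P? : Decidable P) f xs →
                     sumOver f (filter P? xs) ≈ sumOver (λ x → guard (does (P? x)) (f x)) xs
    sumOver-filter P? f []       = refl
    sumOver-filter P? f (x ∷ xs) with does (P? x)
    ... | true  = +-congˡ (sumOver-filter P? f xs)
    ... | false = trans (sumOver-filter P? f xs) (sym (+-identityˡ _))

  sumOver-concatMap : ∀ {A B : Set} f (g : B → List A) xs →
                      sumOver f (concatMap g xs) ≈ sumOver (sumOver f ∘ g) xs
  sumOver-concatMap f g []       = refl
  sumOver-concatMap f g (x ∷ xs) = trans (sumOver-++ f (g x) (concatMap g xs)) (+-congˡ (sumOver-concatMap f g xs))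

  sumOver-applyUpTo : ∀ (g : ℕ → Carrier) f N → sumOver g (applyUpTo f N) ≡ ∑[ i < N ] g (f (toℕ i))
  sumOver-applyUpTo g f zero    = ≡.refl
  sumOver-applyUpTo g f (suc N) = ≡.cong (λ s → g (f 0) + s) (sumOver-applyUpTo g (f ∘ suc) N)

  sumOver-allOfLength-suc : ∀ f k → sumOver f (allOfLength (suc k)) ≈
                            sumOver (λ es → sumOver (λ d → f (d ∷ es)) digits) (allOfLength k)
  sumOver-allOfLength-suc f k = sumOver-concatMap f _ (allOfLength k)

  +-cong₃-≡ : ∀ {a a′ b b′ c c′} → a ≡ a′ → b ≡ b′ → c ≡ c′ →
              a + (b + (c + 0#)) ≡ a′ + (b′ + (c′ + 0#))
  +-cong₃-≡ a≡a′ b≡b′ c≡c′ =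
    ≡.cong₂ _+_ a≡a′ (≡.cong₂ _+_ b≡b′ (≡.cong (_+ 0#) c≡c′))

  module _ (q : Carrier) where
    _^_ : Carrier → ℕ → Carrier
    _^_ = pow R

    digits-odd : ∀ m v p →
                 sumOver (λ d → [ d ℕ.+ 2 ℕ.* v ≡ suc (2 ℕ.* m) ] (q ^ (d ℕ.+ p))) digits ≈
                 q * [ v ≡ m ] (q ^ p)
    digits-odd m v p = begin
      sumOver f digits
        ≡⟨ +-cong₃-≡ ([≢]≡0# _ (even≢odd v m)) ([2*≡2*] v m _)
                     ([≢]≡0# _ (λ eq → even≢odd m v (≡.sym (suc-injective eq)))) ⟩
      0# + ([ v ≡ m ] (q * q ^ p) + (0# + 0#)) ≈⟨ +-identityˡ _ ⟩
      [ v ≡ m ] (q * q ^ p) + (0# + 0#)        ≈⟨ +-congˡ (+-identityˡ 0#) ⟩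
      [ v ≡ m ] (q * q ^ p) + 0#               ≈⟨ +-identityʳ _ ⟩
      [ v ≡ m ] (q * q ^ p)                    ≈⟨ guard-*ˡ _ q _ ⟩
      q * [ v ≡ m ] (q ^ p)                    ∎
      where
      f : ℕ → Carrier
      f d = [ d ℕ.+ 2 ℕ.* v ≡ suc (2 ℕ.* m) ] (q ^ (d ℕ.+ p))

    digits-even : ∀ m v p →
                  sumOver (λ d → [ d ℕ.+ 2 ℕ.* v ≡ suc (suc (2 ℕ.* m)) ] (q ^ (d ℕ.+ p))) digits ≈
                  [ v ≡ suc m ] (q ^ p) + (q * q) * [ v ≡ m ] (q ^ p)
    digits-even m v p = begin
      sumOver f digits
        ≡⟨ +-cong₃-≡ (≡.trans (≡.cong (λ n → [ 2 ℕ.* v ≡ n ] (q ^ p)) (≡.sym (*-suc 2 m)))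
                              ([2*≡2*] v (suc m) (q ^ p)))
                     ([≢]≡0# _ (even≢odd v m ∘ suc-injective))
                     ([2*≡2*] v m _) ⟩
      [ v ≡ suc m ] (q ^ p) + (0# + ([ v ≡ m ] (q * (q * q ^ p)) + 0#))
        ≈⟨ +-congˡ (trans (+-identityˡ _) (+-identityʳ _)) ⟩
      [ v ≡ suc m ] (q ^ p) + [ v ≡ m ] (q * (q * q ^ p))
        ≈⟨ +-congˡ (trans (guard-cong _ (sym (*-assoc q q _))) (guard-*ˡ _ (q * q) _)) ⟩
      [ v ≡ suc m ] (q ^ p) + (q * q) * [ v ≡ m ] (q ^ p) ∎
      where
      f : ℕ → Carrier
      f d = [ d ℕ.+ 2 ℕ.* v ≡ suc (suc (2 ℕ.* m)) ] (q ^ (d ℕ.+ p))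

    weight : ℕ → Mult → Carrier
    weight n ds = guard (does (noTrailingZero? ds)) ([ value ds ≡ n ] (q ^ numParts ds))

    -- For es = [] the guard on the right is vacuous; this is harmless as [ 0 ] has value 0 ≠ suc n.
    weight-∷ : ∀ n d es → weight (suc n) (d ∷ es) ≡
               guard (does (noTrailingZero? es)) ([ value (d ∷ es) ≡ suc n ] (q ^ numParts (d ∷ es)))
    weight-∷ n zero    []       = ≡.refl
    weight-∷ n (suc d) []       = ≡.refl
    weight-∷ n d       (e ∷ es) =
      ≡.cong (λ b → guard b ([ value (d ∷ e ∷ es) ≡ suc n ] (q ^ numParts (d ∷ e ∷ es))))
             (noTrailingZero?-∷ d e es)

    weight-zero-∷ : ∀ d ds → weight 0 (d ∷ ds) ≡ 0#
    weight-zero-∷ zero    []       = ≡.refl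
    weight-zero-∷ (suc d) []       = ≡.refl
    weight-zero-∷ zero    (e ∷ es) =
      ≡.trans (≡.cong₂ guard (noTrailingZero?-∷ 0 e es) ([2*≡2*] (value (e ∷ es)) 0 _))
              (weight-zero-∷ e es)
    weight-zero-∷ (suc d) (e ∷ es) = guard-0# _

    weight-digits-odd : ∀ m es → sumOver (λ d → weight (suc (2 ℕ.* m)) (d ∷ es)) digits ≈ q * weight m es
    weight-digits-odd m es = begin
      sumOver (λ d → weight (suc (2 ℕ.* m)) (d ∷ es)) digits
        ≈⟨ sumOver-cong digits (λ d → reflexive (weight-∷ (2 ℕ.* m) d es)) ⟩
      sumOver (λ d → guard b (f d)) digits
        ≈⟨ sumOver-guard b f digits ⟩
      guard b (sumOver f digits)
        ≈⟨ guard-cong b (digits-odd m (value es) (numParts es)) ⟩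
      guard b (q * [ value es ≡ m ] (q ^ numParts es))
        ≈⟨ guard-*ˡ b q _ ⟩
      q * weight m es ∎
      where
      b : Bool
      b = does (noTrailingZero? es)
      f : ℕ → Carrier
      f d = [ d ℕ.+ 2 ℕ.* value es ≡ suc (2 ℕ.* m) ] (q ^ (d ℕ.+ numParts es))

    weight-digits-even : ∀ m es → sumOver (λ d → weight (suc (suc (2 ℕ.* m))) (d ∷ es)) digits ≈
                                  weight (suc m) es + (q * q) * weight m es
    weight-digits-even m es = begin
      sumOver (λ d → weight (suc (suc (2 ℕ.* m))) (d ∷ es)) digits
        ≈⟨ sumOver-cong digits (λ d → reflexive (weight-∷ (suc (2 ℕ.* m)) d es)) ⟩
      sumOver (λ d → guard b (f d)) digits
        ≈⟨ sumOver-guard b f digits ⟩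
      guard b (sumOver f digits)
        ≈⟨ guard-cong b (digits-even m (value es) (numParts es)) ⟩
      guard b ([ value es ≡ suc m ] (q ^ numParts es) + (q * q) * [ value es ≡ m ] (q ^ numParts es))
        ≈⟨ trans (guard-+ b _ _) (+-congˡ (guard-*ˡ b (q * q) _)) ⟩
      weight (suc m) es + (q * q) * weight m es ∎
      where
      b : Bool
      b = does (noTrailingZero? es)
      f : ℕ → Carrier
      f d = [ d ℕ.+ 2 ℕ.* value es ≡ suc (suc (2 ℕ.* m)) ] (q ^ (d ℕ.+ numParts es))

    hLength : ℕ → ℕ → Carrier
    hLength n k = sumOver (weight n) (allOfLength k)

    hLength-zero : ∀ k → hLength 0 (suc k) ≈ 0#
    hLength-zero k = trans (sumOver-allOfLength-suc (weight 0) k)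
      (sumOver-zero (allOfLength k) (λ es → sumOver-zero digits (λ d → reflexive (weight-zero-∷ d es))))

    hLength-odd : ∀ m k → hLength (suc (2 ℕ.* m)) (suc k) ≈ q * hLength m k
    hLength-odd m k = begin
      hLength (suc (2 ℕ.* m)) (suc k)
        ≈⟨ sumOver-allOfLength-suc _ k ⟩
      sumOver (λ es → sumOver (λ d → weight (suc (2 ℕ.* m)) (d ∷ es)) digits) (allOfLength k)
        ≈⟨ sumOver-cong (allOfLength k) (weight-digits-odd m) ⟩
      sumOver (λ es → q * weight m es) (allOfLength k)
        ≈⟨ sumOver-*ˡ q (weight m) (allOfLength k) ⟩
      q * hLength m k ∎

    hLength-even : ∀ m k → hLength (suc (suc (2 ℕ.* m))) (suc k) ≈ hLength (suc m) k + (q * q) * hLength m k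
    hLength-even m k = begin
      hLength (suc (suc (2 ℕ.* m))) (suc k)
        ≈⟨ sumOver-allOfLength-suc _ k ⟩
      sumOver (λ es → sumOver (λ d → weight (suc (suc (2 ℕ.* m))) (d ∷ es)) digits) (allOfLength k)
        ≈⟨ sumOver-cong (allOfLength k) (weight-digits-even m) ⟩
      sumOver (λ es → weight (suc m) es + (q * q) * weight m es) (allOfLength k)
        ≈⟨ sumOver-+ (weight (suc m)) _ (allOfLength k) ⟩
      hLength (suc m) k + sumOver (λ es → (q * q) * weight m es) (allOfLength k)
        ≈⟨ +-congˡ (sumOver-*ˡ (q * q) (weight m) (allOfLength k)) ⟩
      hLength (suc m) k + (q * q) * hLength m k ∎

    hLength-0 : ∀ n → hLength n 0 ≈ [ 0 ≡ n ] 1#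
    hLength-0 n = +-identityʳ _

    hBelow : ℕ → ℕ → Carrier
    hBelow n N = ∑[ k < N ] hLength n (toℕ k)

    hBelow-zero : ∀ N → hBelow 0 (suc N) ≈ 1#
    hBelow-zero N = begin
      hLength 0 0 + ∑[ k < N ] hLength 0 (suc (toℕ k))
        ≈⟨ +-cong (hLength-0 0) (sum-cong-≋ {N} (hLength-zero ∘ toℕ)) ⟩
      1# + ∑[ k < N ] 0#  ≈⟨ +-congˡ (sum-replicate-zero N) ⟩
      1# + 0#             ≈⟨ +-identityʳ 1# ⟩
      1#                  ∎

    hBelow-odd : ∀ m N → hBelow (suc (2 ℕ.* m)) (suc N) ≈ q * hBelow m N
    hBelow-odd m N = begin
      hLength (suc (2 ℕ.* m)) 0 + ∑[ k < N ] hLength (suc (2 ℕ.* m)) (suc (toℕ k))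
        ≈⟨ +-cong (hLength-0 (suc (2 ℕ.* m))) (sum-cong-≋ {N} (hLength-odd m ∘ toℕ)) ⟩
      0# + ∑[ k < N ] (q * hLength m (toℕ k)) ≈⟨ +-identityˡ _ ⟩
      ∑[ k < N ] (q * hLength m (toℕ k))      ≈⟨ *-distribˡ-sum {N} q (hLength m ∘ toℕ) ⟨
      q * hBelow m N                       ∎

    hBelow-even : ∀ m N → hBelow (suc (suc (2 ℕ.* m))) (suc N) ≈ hBelow (suc m) N + (q * q) * hBelow m N
    hBelow-even m N = begin
      hLength (suc (suc (2 ℕ.* m))) 0 + ∑[ k < N ] hLength (suc (suc (2 ℕ.* m))) (suc (toℕ k))
        ≈⟨ +-cong (hLength-0 (suc (suc (2 ℕ.* m)))) (sum-cong-≋ {N} (hLength-even m ∘ toℕ)) ⟩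
      0# + ∑[ k < N ] (hLength (suc m) (toℕ k) + (q * q) * hLength m (toℕ k)) ≈⟨ +-identityˡ _ ⟩
      ∑[ k < N ] (hLength (suc m) (toℕ k) + (q * q) * hLength m (toℕ k))
        ≈⟨ ∑-distrib-+ {N} (hLength (suc m) ∘ toℕ) (λ k → (q * q) * hLength m (toℕ k)) ⟩
      hBelow (suc m) N + ∑[ k < N ] ((q * q) * hLength m (toℕ k))
        ≈⟨ +-congˡ (*-distribˡ-sum {N} (q * q) (hLength m ∘ toℕ)) ⟨
      hBelow (suc m) N + (q * q) * hBelow m N ∎

    hBelow-suc : ∀ N {n} → n < N → hBelow n (suc N) ≈ hBelow n N
    hBelow-suc (suc N) {n} n<N with halving n
    ... | zero   = trans (hBelow-zero (suc N)) (sym (hBelow-zero N))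
    ... | 1+2* m = begin
      hBelow (suc (2 ℕ.* m)) (suc (suc N)) ≈⟨ hBelow-odd m (suc N) ⟩
      q * hBelow m (suc N)                 ≈⟨ *-congˡ (hBelow-suc N m<N) ⟩
      q * hBelow m N                       ≈⟨ hBelow-odd m N ⟨
      hBelow (suc (2 ℕ.* m)) (suc N)       ∎
      where
      m<N : m < N
      m<N = ≤-trans (s≤s (m≤m+n m (m ℕ.+ 0))) (s≤s⁻¹ n<N)
    ... | 2+2* m = begin
      hBelow (suc (suc (2 ℕ.* m))) (suc (suc N))            ≈⟨ hBelow-even m (suc N) ⟩
      hBelow (suc m) (suc N) + (q * q) * hBelow m (suc N)
        ≈⟨ +-cong (hBelow-suc N 1+m<N) (*-congˡ (hBelow-suc N (≤-trans (n≤1+n (suc m)) 1+m<N))) ⟩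
      hBelow (suc m) N + (q * q) * hBelow m N               ≈⟨ hBelow-even m N ⟨
      hBelow (suc (suc (2 ℕ.* m))) (suc N)                  ∎
      where
      1+m<N : suc m < N
      1+m<N = ≤-trans (s≤s (s≤s (m≤m+n m (m ℕ.+ 0)))) (s≤s⁻¹ n<N)

    hBelow-stable : ∀ {n N} → n < N → hBelow n N ≈ hBelow n (suc n)
    hBelow-stable {n} {suc N} (s≤s n≤N) with m≤n⇒m<n∨m≡n n≤N
    ... | inj₁ n<N   = trans (hBelow-suc N n<N) (hBelow-stable n<N)
    ... | inj₂ ≡.refl = refl

    h≈hBelow-suc : ∀ n → h R q (+ n) ≈ hBelow n (suc n)
    h≈hBelow-suc n = begin
      h R q (+ n)
        ≈⟨ sumOver-filter (λ ds → value ds ≟ n) (λ ds → q ^ numParts ds) (filter noTrailingZero? L) ⟩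
      sumOver (λ ds → [ value ds ≡ n ] (q ^ numParts ds)) (filter noTrailingZero? L)
        ≈⟨ sumOver-filter noTrailingZero? _ L ⟩
      sumOver (weight n) L
        ≈⟨ sumOver-concatMap (weight n) allOfLength (upTo (suc n)) ⟩
      sumOver (hLength n) (upTo (suc n))
        ≡⟨ sumOver-applyUpTo (hLength n) id (suc n) ⟩
      hBelow n (suc n) ∎
      where
      L : List Mult
      L = concatMap allOfLength (upTo (suc n))

    h≈hBelow : ∀ n N → n < N → h R q (+ n) ≈ hBelow n N
    h≈hBelow n N n<N = trans (h≈hBelow-suc n) (sym (hBelow-stable n<N))

    h-odd : ∀ m → h R q (+ suc (2 ℕ.* m)) ≈ q * h R q (+ m)
    h-odd m = begin
      h R q (+ suc (2 ℕ.* m))                     ≈⟨ h≈hBelow _ _ (n<1+n (suc (2 ℕ.* m))) ⟩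
      hBelow (suc (2 ℕ.* m)) (suc (suc (2 ℕ.* m))) ≈⟨ hBelow-odd m (suc (2 ℕ.* m)) ⟩
      q * hBelow m (suc (2 ℕ.* m))                 ≈⟨ *-congˡ (h≈hBelow m _ m<1+2m) ⟨
      q * h R q (+ m)                              ∎
      where
      m<1+2m : m < suc (2 ℕ.* m)
      m<1+2m = s≤s (m≤m+n m (m ℕ.+ 0))

    h-even : ∀ m → h R q (+ suc (suc (2 ℕ.* m))) ≈ h R q (+ suc m) + (q * q) * h R q (+ m)
    h-even m = begin
      h R q (+ suc (suc (2 ℕ.* m)))                           ≈⟨ h≈hBelow _ _ (n<1+n (suc (suc (2 ℕ.* m)))) ⟩
      hBelow (suc (suc (2 ℕ.* m))) (suc (suc (suc (2 ℕ.* m)))) ≈⟨ hBelow-even m (suc (suc (2 ℕ.* m))) ⟩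
      hBelow (suc m) (suc (suc (2 ℕ.* m))) + (q * q) * hBelow m (suc (suc (2 ℕ.* m)))
        ≈⟨ +-cong (h≈hBelow (suc m) _ 1+m<2+2m)
                  (*-congˡ (h≈hBelow m _ (≤-trans (n≤1+n (suc m)) 1+m<2+2m))) ⟨
      h R q (+ suc m) + (q * q) * h R q (+ m)                 ∎
      where
      1+m<2+2m : suc m < suc (suc (2 ℕ.* m))
      1+m<2+2m = s≤s (s≤s (m≤m+n m (m ℕ.+ 0)))

proposition2p2 : ∀ {c ℓ : Level} (R : CommutativeSemiring c ℓ) (q : CommutativeSemiring.Carrier R) →
    let open CommutativeSemiring R in
    (h R q (-[1+ 0 ]) ≈ 0#) ×
    (h R q (+ 0) ≈ 1#) ×
    (∀ (n : ℕ) → h R q (+ 2 ℤ.* + suc n ℤ.- + 1) ≈ q * h R q (+ suc n ℤ.- + 1)) ×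
    (∀ (n : ℕ) → h R q (+ 2 ℤ.* + suc n) ≈ h R q (+ suc n) + (q * q) * h R q (+ suc n ℤ.- + 1))
proposition2p2 R q = refl , +-identityʳ 1# , odd , even
  where
  open CommutativeSemiring R

  -- + 2 ℤ.* + suc n ℤ.- + 1 computes to + (n + suc (n + 0)), and + 2 ℤ.* + suc n to + (2 * suc n).
  odd : ∀ n → h R q (+ 2 ℤ.* + suc n ℤ.- + 1) ≈ q * h R q (+ n)
  odd n = trans (reflexive (≡.cong (h R q ∘ +_) (+-suc n (n ℕ.+ 0)))) (h-odd R q n)

  even : ∀ n → h R q (+ 2 ℤ.* + suc n) ≈ h R q (+ suc n) + (q * q) * h R q (+ n)
  even n = trans (reflexive (≡.cong (h R q ∘ +_) (*-suc 2 n))) (h-even R q n)
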